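{- For any $\mathfrak{R}\subseteq\underline{V}\times\underline{V}$, the statement $\neg\varphi^{\mathfrak{R}}$ is compositional, i.e., for all lex models $\pi,\pi'$, if $\pi\models\neg\varphi^{\mathfrak{R}}$ and $\pi'\models\neg\varphi^{\mathfrak{R}}$ then $\pi\circ\pi'\models\neg\varphi^{\mathfrak{R}}$.
   Context: Let $V$ be a finite set of variables with finite nonempty domains; $\underline{V}$ is the set of outcomes (full assignments); $\alpha(U)$ is restriction. A lex model $\pi$ is a (possibly empty) sequence $(Y_1,\ge_{Y_1}),\ldots,(Y_k,\ge_{Y_k})$ of pairwise distinct variables each with a total order on its domain; $V_\pi=\{Y_1,\ldots,Y_k\}$. $\alpha\succ_\pi\beta$ iff for some $i$, $\alpha(Y_j)=\beta(Y_j)$ for $j<i$ and $\alpha(Y_i)>_{Y_i}\beta(Y_i)$ strictly; $\alpha\equiv_\pi\beta$ iff $\alpha(V_\pi)=\beta(V_\pi)$; $\alpha\succcurlyeq_\pi\beta$ iff $\alpha\succ_\pi\beta$ or $\alpha\equiv_\pi\beta$, viewed as a subset of $\underline{V}\times\underline{V}$. For $\pi'=(Z_1,\ge_{Z_1}),\ldots$, $\pi\circ\pi'$ is $\pi$ followed by $\pi'$ with pairs whose variable is in $V_\pi$ deleted. $\varphi^{\mathfrak{R}}$ is a statement with $\pi\models\varphi^{\mathfrak{R}}$ iff $\succcurlyeq_\pi\supseteq\mathfrak{R}$, and $\pi\models\neg\varphi^{\mathfrak{R}}$ iff $\pi\not\models\varphi^{\mathfrak{R}}$. -}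

module Defs where

open import Level using (0ℓ)
open import Data.Nat using (ℕ; NonZero)
open import Data.Fin using (Fin; _≟_)
open import Data.Product using (Σ; _×_; _,_; proj₁)
open import Data.Sum using (_⊎_)
open import Data.Empty using (⊥)
open import Data.List using (List; []; _∷_; _++_; map; filter)
open import Data.List.Relation.Unary.All using (All)
open import Data.List.Relation.Unary.Unique.Propositional using (Unique)
open import Data.List.Membership.DecPropositional using (_∈?_)
open import Relation.Nullary using (¬_)
open import Relation.Nullary.Decidable using (¬?)
open import Relation.Binary using (Rel; IsTotalOrder)
open import Relation.Binary.PropositionalEquality using (_≡_; _≢_)

-- A variable set V = Fin n, with domain sizes d; each domain Fin (d Y).
-- Outcomes: full assignments.
Outcome : {n : ℕ} → (Fin n → ℕ) → Set
Outcome {n} d = (Y : Fin n) → Fin (d Y)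

-- One pair (Y, ≥_Y) of a lex model: a variable with a total order on its domain
-- (the order relation R a b is read as  a ≥_Y b).
record Entry {n : ℕ} (d : Fin n → ℕ) : Set₁ where
  constructor entry
  field
    var     : Fin n
    geq     : Rel (Fin (d var)) 0ℓ
    isTotal : IsTotalOrder _≡_ geq
open Entry public

-- Raw lex model: a list of entries; a lex model additionally has pairwise distinct variables.
LexModel : {n : ℕ} → (Fin n → ℕ) → Set₁
LexModel d = List (Entry d)

vars : {n : ℕ} {d : Fin n → ℕ} → LexModel d → List (Fin n)
vars π = map var π

IsLexModel : {n : ℕ} {d : Fin n → ℕ} → LexModel d → Set
IsLexModel π = Unique (vars π)

Strict : {n : ℕ} {d : Fin n → ℕ} (e : Entry d) → Fin (d (var e)) → Fin (d (var e)) → Set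
Strict e a b = geq e a b × a ≢ b

_≻⟨_⟩_ : {n : ℕ} {d : Fin n → ℕ} → Outcome d → LexModel d → Outcome d → Set
α ≻⟨ [] ⟩ β = ⊥
α ≻⟨ e ∷ π ⟩ β = Strict e (α (var e)) (β (var e)) ⊎ (α (var e) ≡ β (var e) × α ≻⟨ π ⟩ β)

_≡⟨_⟩_ : {n : ℕ} {d : Fin n → ℕ} → Outcome d → LexModel d → Outcome d → Set
α ≡⟨ π ⟩ β = All (λ Y → α Y ≡ β Y) (vars π)

_≽⟨_⟩_ : {n : ℕ} {d : Fin n → ℕ} → Outcome d → LexModel d → Outcome d → Set
α ≽⟨ π ⟩ β = α ≻⟨ π ⟩ β ⊎ α ≡⟨ π ⟩ β

_∘ₗ_ : {n : ℕ} {d : Fin n → ℕ} → LexModel d → LexModel d → LexModel d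
_∘ₗ_ {n} π π' = π ++ filter (λ e → ¬? ((_∈?_ (_≟_ {n})) (var e) (vars π))) π'

_⊨φ_ : {n : ℕ} {d : Fin n → ℕ} → LexModel d → (Outcome d → Outcome d → Set) → Set
π ⊨φ 𝔑 = ∀ α β → 𝔑 α β → α ≽⟨ π ⟩ β

_⊨¬φ_ : {n : ℕ} {d : Fin n → ℕ} → LexModel d → (Outcome d → Outcome d → Set) → Set
π ⊨¬φ 𝔑 = ¬ (π ⊨φ 𝔑)

-- A lex order refines the lex order of each of its prefixes: if α ≽ β for
-- π ++ ρ then already α ≽ β for π. Since π is a prefix of π ∘ π', any
-- π ∘ π' satisfying φ^𝔑 would make π satisfy it.
{-# OPTIONS --safe #-}
module Submission where

open import Defs
open import Data.Nat using (ℕ; NonZero)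
open import Data.Fin using (Fin)
open import Data.List using (_∷_; []; _++_)
open import Data.List.Relation.Unary.All using ([]; _∷_)
open import Data.List.Relation.Unary.All.Properties using (map⁺; map⁻; ++⁻ˡ)
open import Data.Sum using (inj₁; inj₂)
open import Data.Product using (_,_)

module _ {n : ℕ} {d : Fin n → ℕ} {α β : Outcome d} where

  ≻-++⁻ˡ : ∀ π {ρ} → α ≻⟨ π ++ ρ ⟩ β → α ≽⟨ π ⟩ β
  ≻-++⁻ˡ []      _                 = inj₂ []
  ≻-++⁻ˡ (e ∷ π) (inj₁ α>β)        = inj₁ (inj₁ α>β)
  ≻-++⁻ˡ (e ∷ π) (inj₂ (α≡β , ≻ρ)) with ≻-++⁻ˡ π ≻ρ
  ... | inj₁ ≻π = inj₁ (inj₂ (α≡β , ≻π))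
  ... | inj₂ ≡π = inj₂ (α≡β ∷ ≡π)

  ≡-++⁻ˡ : ∀ π {ρ} → α ≡⟨ π ++ ρ ⟩ β → α ≡⟨ π ⟩ β
  ≡-++⁻ˡ π ≡πρ = map⁺ (++⁻ˡ π (map⁻ ≡πρ))

  ≽-++⁻ˡ : ∀ π {ρ} → α ≽⟨ π ++ ρ ⟩ β → α ≽⟨ π ⟩ β
  ≽-++⁻ˡ π (inj₁ ≻πρ) = ≻-++⁻ˡ π ≻πρ
  ≽-++⁻ˡ π (inj₂ ≡πρ) = inj₂ (≡-++⁻ˡ π ≡πρ)

module _ {n : ℕ} {d : Fin n → ℕ} {𝔑 : Outcome d → Outcome d → Set} where

  ⊨φ-++⁻ˡ : ∀ π {ρ} → (π ++ ρ) ⊨φ 𝔑 → π ⊨φ 𝔑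
  ⊨φ-++⁻ˡ π πρ⊨φ α β 𝔑αβ = ≽-++⁻ˡ π (πρ⊨φ α β 𝔑αβ)

  ⊨¬φ-++⁺ˡ : ∀ π {ρ} → π ⊨¬φ 𝔑 → (π ++ ρ) ⊨¬φ 𝔑
  ⊨¬φ-++⁺ˡ π π⊨¬φ πρ⊨φ = π⊨¬φ (⊨φ-++⁻ˡ π πρ⊨φ)

proposition8 : (n : ℕ) (d : Fin n → ℕ) → (∀ Y → NonZero (d Y))
    → (𝔑 : Outcome d → Outcome d → Set)
    → (π π' : LexModel d) → IsLexModel π → IsLexModel π'
    → π ⊨¬φ 𝔑 → π' ⊨¬φ 𝔑 → (π ∘ₗ π') ⊨¬φ 𝔑
proposition8 n d _ 𝔑 π π' _ _ π⊨¬φ _ = ⊨¬φ-++⁺ˡ π π⊨¬φ
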